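{- A pure simplicial complex $\Delta$ is strongly shellable if and only if its codimension one graph $\Gamma(\Delta)$ is harmonious with respect to $\Delta$ and $\Gamma(\Delta)$ has a distance-preserving order.
   Context: A simplicial complex $\Delta$ is a finite family of subsets of a vertex set closed under taking subsets; $\mathcal{F}(\Delta)$ is its set of facets, $\dim(A)=|A|-1$; $\Delta$ is pure if all facets have the same dimension. A linear order $F_1,\dots,F_t$ of $\mathcal{F}(\Delta)$ is a strong shelling order if for every $1\le i<j\le t$ there exists $k$ with $1\le k<j$ such that $|F_j\setminus F_k|=1$, $F_j\setminus F_k\subseteq F_j\setminus F_i$, and $F_k\setminus F_j\subseteq F_i$; $\Delta$ is strongly shellable if such an order exists. For facets $F,G$, $\operatorname{dis}_\Delta(F,G):=\min(\dim F,\dim G)-\dim(F\cap G)$ $(=\min(|F\setminus G|,|G\setminus F|))$. The codimension one graph $\Gamma(\Delta)$ is the simple graph with vertex set $\mathcal{F}(\Delta)$ in which $F,G$ are adjacent iff $\operatorname{dis}_\Delta(F,G)=1$. $\Gamma(\Delta)$ is harmonious with respect to $\Delta$ if $\operatorname{dis}_\Delta(F,G)=\operatorname{dis}_{\Gamma(\Delta)}(F,G)$ for all facets $F,G$, where $\operatorname{dis}_{\Gamma(\Delta)}$ is the graph distance (possibly $+\infty$). For a finite simple graph $G$, an ordering $v_1,\dots,v_t$ of its vertices is a distance-preserving order if, writing $G_0=G$ and $G_k$ for the induced subgraph on $\{v_{k+1},\dots,v_t\}$, for each $1\le i<t-1$ one has $\operatorname{dis}_{G_i}(u,v)=\operatorname{dis}_{G_{i-1}}(u,v)$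 for all vertices $u,v$ of $G_i$. -}

module Defs where

open import Data.Bool using (Bool; true)
open import Data.Nat using (ℕ; zero; suc; _<_; _≤_; _⊓_; _∸_)
open import Data.Fin using (Fin) renaming (_<_ to _<ᶠ_)
open import Data.Fin.Subset using (Subset; _⊆_; _∩_; _─_; ∣_∣)
open import Data.List using (List; length; lookup; drop)
open import Data.List.Membership.Propositional using () renaming (_∈_ to _∈ˡ_)
open import Data.List.Relation.Unary.Unique.Propositional using (Unique)
open import Data.Maybe using (Maybe; just; nothing)
open import Data.Product using (Σ; ∃; ∃-syntax; _×_)
open import Relation.Binary.PropositionalEquality using (_≡_)
open import Relation.Nullary using (¬_)
open import Function.Bundles using (_⇔_)

record SimplicialComplex (n : ℕ) : Set where
  field
    face    : Subset n → Bool
    closed  : ∀ (A B : Subset n) → B ⊆ A → face A ≡ true → face B ≡ true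

open SimplicialComplex public

IsFace : ∀ {n} → SimplicialComplex n → Subset n → Set
IsFace Δ A = face Δ A ≡ true

IsFacet : ∀ {n} → SimplicialComplex n → Subset n → Set
IsFacet Δ F = IsFace Δ F × (∀ G → IsFace Δ G → F ⊆ G → F ≡ G)

Pure : ∀ {n} → SimplicialComplex n → Set
Pure Δ = ∀ F G → IsFacet Δ F → IsFacet Δ G → ∣ F ∣ ≡ ∣ G ∣

-- dis_Δ(F,G) = min(dim F, dim G) - dim(F ∩ G)
--            = min(|F|,|G|) - |F ∩ G|   (the "-1"s cancel)
dis : ∀ {n} → Subset n → Subset n → ℕ
dis F G = (∣ F ∣ ⊓ ∣ G ∣) ∸ ∣ F ∩ G ∣

FacetOrder : ∀ {n} → SimplicialComplex n → List (Subset n) → Set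
FacetOrder Δ Fs = Unique Fs × (∀ F → (F ∈ˡ Fs) ⇔ IsFacet Δ F)

-- Strong shelling order condition (indices 0-based).
StrongShellingOrder : ∀ {n} → SimplicialComplex n → List (Subset n) → Set
StrongShellingOrder Δ Fs =
  FacetOrder Δ Fs ×
  (∀ (i j : Fin (length Fs)) → i <ᶠ j →
     ∃[ k ] (k <ᶠ j
            × ∣ lookup Fs j ─ lookup Fs k ∣ ≡ 1
            × (lookup Fs j ─ lookup Fs k) ⊆ (lookup Fs j ─ lookup Fs i)
            × (lookup Fs k ─ lookup Fs j) ⊆ lookup Fs i))

StronglyShellable : ∀ {n} → SimplicialComplex n → Set
StronglyShellable Δ = ∃[ Fs ] StrongShellingOrder Δ Fs

data Walk {V : Set} (S : V → Set) (E : V → V → Set) : V → V → ℕ → Set where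
  here : ∀ {u} → S u → Walk S E u u zero
  step : ∀ {u w v m} → S u → E u w → Walk S E w v m → Walk S E u v (suc m)

-- Graph distance with values in ℕ ∪ {∞}  (nothing = +∞).
HasDist : {V : Set} → (V → Set) → (V → V → Set) → V → V → Maybe ℕ → Set
HasDist S E u v (just d) = Walk S E u v d × (∀ m → Walk S E u v m → d ≤ m)
HasDist S E u v nothing  = ∀ m → ¬ Walk S E u v m

SameDist : {V : Set} → (V → Set) → (V → Set) → (V → V → Set) → V → V → Set
SameDist S S' E u v = ∀ d → HasDist S E u v d ⇔ HasDist S' E u v d

-- Distance-preserving order of the graph (Vert, E):
-- ord = v_1 … v_t lists each vertex exactly once; G_k is the subgraph induced on
-- {v_{k+1},…,v_t} = drop k ord; for 1 ≤ i < t-1 distances in G_i agree with G_{i-1}.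
DistancePreservingOrder : {V : Set} → (V → Set) → (V → V → Set) → List V → Set
DistancePreservingOrder {V} Vert E ord =
  Unique ord × (∀ x → (x ∈ˡ ord) ⇔ Vert x) ×
  (∀ (i : ℕ) → 1 ≤ i → suc i < length ord →
     ∀ u v → u ∈ˡ drop i ord → v ∈ˡ drop i ord →
       SameDist (_∈ˡ drop i ord) (_∈ˡ drop (i ∸ 1) ord) E u v)

HasDistancePreservingOrder : {V : Set} → (V → Set) → (V → V → Set) → Set
HasDistancePreservingOrder {V} Vert E = ∃[ ord ] DistancePreservingOrder Vert E ord

ΓVert : ∀ {n} → SimplicialComplex n → Subset n → Set
ΓVert Δ = IsFacet Δ

ΓAdj : ∀ {n} → SimplicialComplex n → Subset n → Subset n → Set
ΓAdj Δ F G = IsFacet Δ F × IsFacet Δ G × dis F G ≡ 1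

Harmonious : ∀ {n} → SimplicialComplex n → Set
Harmonious Δ = ∀ F G → IsFacet Δ F → IsFacet Δ G →
  HasDist (ΓVert Δ) (ΓAdj Δ) F G (just (dis F G))

-- For facets of a pure complex, dis F G = ∣ F ─ G ∣ is a metric and no Γ-walk is shorter than dis.
-- The identity  ∣F─I∣ + ∣(F─K) ∩ I∣ + ∣(K─F)─I∣ = ∣F─K∣ + ∣K─I∣  shows that the strong shelling
-- condition for F_i before F_j says exactly: some earlier F_k is a Γ-neighbour of F_j lying on a
-- dis-geodesic from F_j to F_i.  Iterating, in a strong shelling order any two of F_0 … F_s are joined
-- by a geodesic inside F_0 … F_s; so Γ is harmonious, and the reversed order, which deletes facets
-- from the end, preserves distances.  Conversely, given harmony and a distance-preserving order,
-- reverse it: distances inside F_0 … F_j still equal dis, and the second vertex of a shortest walk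
-- from F_j to F_i there is the required F_k.

module Submission where

open import Defs
open import Data.Bool using (true; false)
open import Data.Fin using (Fin; zero; suc; toℕ) renaming (_<_ to _<ᶠ_)
open import Data.Fin.Properties using (toℕ<n; toℕ-injective) renaming (<-cmp to <ᶠ-cmp; <⇒≢ to <ᶠ⇒≢)
open import Data.Fin.Subset using (Subset; _∈_; _∉_; _⊆_; _∩_; _─_; ∣_∣)
open import Data.Fin.Subset.Properties
  using (∩-comm; ∩-idem; ∣⊥∣≡0; Empty-unique; x∈p⇒∣p-x∣<∣p∣; x∈p∩q⁺; x∈p∩q⁻; p─q⊆p; x∈p∧x∉q⇒x∈p─q; _∈?_)
open import Data.Vec.Base using ([]; _∷_) renaming (here to hereᵛ; there to thereᵛ)
open import Data.List using (List; []; _∷_; [_]; _++_; length; lookup; drop; reverse)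
open import Data.List.Properties using (unfold-reverse; length-reverse; reverse-involutive; drop-[])
open import Data.List.Membership.Propositional using () renaming (_∈_ to _∈ˡ_)
open import Data.List.Membership.Propositional.Properties using (∈-++⁻; ∈-++⁺ˡ; ∈-++⁺ʳ; ∈-lookup)
import Data.List.Relation.Unary.All as All
open import Data.List.Relation.Unary.AllPairs using (_∷_)
open import Data.List.Relation.Unary.Any using (here; there)
open import Data.List.Relation.Unary.Any.Properties using (reverse⁺; reverse⁻)
open import Data.List.Relation.Unary.Unique.Propositional using (Unique)
open import Data.List.Relation.Binary.Permutation.Propositional using (↭-sym; ↭⇒↭ₛ)
open import Data.List.Relation.Binary.Permutation.Propositional.Properties using (↭-reverse)
import Data.List.Relation.Binary.Permutation.Setoid.Properties as ↭ₛ
open import Data.Maybe using (just; nothing)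
open import Data.Nat using (ℕ; zero; suc; _+_; _∸_; _⊓_; _≤_; _<_; z≤n; s≤s)
open import Data.Nat.Properties
open import Data.Product using (∃-syntax; _×_; _,_; proj₁; proj₂)
open import Data.Sum using (inj₁; inj₂)
open import Function.Bundles using (_⇔_; mk⇔; Equivalence)
import Function.Properties.Equivalence as ⇔
open import Relation.Binary.Definitions using (tri<; tri≈; tri>)
open import Relation.Binary.PropositionalEquality hiding ([_])
open import Relation.Nullary using (yes; no; contradiction)

open Equivalence using (to; from)

∣p─q∣+∣p∩q∣≡∣p∣ : ∀ {n} (p q : Subset n) → ∣ p ─ q ∣ + ∣ p ∩ q ∣ ≡ ∣ p ∣
∣p─q∣+∣p∩q∣≡∣p∣ []          []          = refl
∣p─q∣+∣p∩q∣≡∣p∣ (true ∷ p)  (true ∷ q)  = trans (+-suc _ _) (cong suc (∣p─q∣+∣p∩q∣≡∣p∣ p q))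
∣p─q∣+∣p∩q∣≡∣p∣ (true ∷ p)  (false ∷ q) = cong suc (∣p─q∣+∣p∩q∣≡∣p∣ p q)
∣p─q∣+∣p∩q∣≡∣p∣ (false ∷ p) (true ∷ q)  = ∣p─q∣+∣p∩q∣≡∣p∣ p q
∣p─q∣+∣p∩q∣≡∣p∣ (false ∷ p) (false ∷ q) = ∣p─q∣+∣p∩q∣≡∣p∣ p q

∣p─r∣+∣[p─q]∩r∣+∣q─p─r∣≡∣p─q∣+∣q─r∣ : ∀ {n} (p q r : Subset n) →
  ∣ p ─ r ∣ + ∣ (p ─ q) ∩ r ∣ + ∣ q ─ p ─ r ∣ ≡ ∣ p ─ q ∣ + ∣ q ─ r ∣
∣p─r∣+∣[p─q]∩r∣+∣q─p─r∣≡∣p─q∣+∣q─r∣ [] [] [] = refl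
∣p─r∣+∣[p─q]∩r∣+∣q─p─r∣≡∣p─q∣+∣q─r∣ (true ∷ p) (true ∷ q) (true ∷ r) =
  ∣p─r∣+∣[p─q]∩r∣+∣q─p─r∣≡∣p─q∣+∣q─r∣ p q r
∣p─r∣+∣[p─q]∩r∣+∣q─p─r∣≡∣p─q∣+∣q─r∣ (true ∷ p) (true ∷ q) (false ∷ r) =
  trans (cong suc (∣p─r∣+∣[p─q]∩r∣+∣q─p─r∣≡∣p─q∣+∣q─r∣ p q r)) (sym (+-suc _ _))
∣p─r∣+∣[p─q]∩r∣+∣q─p─r∣≡∣p─q∣+∣q─r∣ (true ∷ p) (false ∷ q) (true ∷ r) =
  trans (cong (_+ ∣ q ─ p ─ r ∣) (+-suc ∣ p ─ r ∣ _)) (cong suc (∣p─r∣+∣[p─q]∩r∣+∣q─p─r∣≡∣p─q∣+∣q─r∣ p q r))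
∣p─r∣+∣[p─q]∩r∣+∣q─p─r∣≡∣p─q∣+∣q─r∣ (true ∷ p) (false ∷ q) (false ∷ r) =
  cong suc (∣p─r∣+∣[p─q]∩r∣+∣q─p─r∣≡∣p─q∣+∣q─r∣ p q r)
∣p─r∣+∣[p─q]∩r∣+∣q─p─r∣≡∣p─q∣+∣q─r∣ (false ∷ p) (true ∷ q) (true ∷ r) =
  ∣p─r∣+∣[p─q]∩r∣+∣q─p─r∣≡∣p─q∣+∣q─r∣ p q r
∣p─r∣+∣[p─q]∩r∣+∣q─p─r∣≡∣p─q∣+∣q─r∣ (false ∷ p) (true ∷ q) (false ∷ r) =
  trans (+-suc _ _) (trans (cong suc (∣p─r∣+∣[p─q]∩r∣+∣q─p─r∣≡∣p─q∣+∣q─r∣ p q r)) (sym (+-suc _ _)))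
∣p─r∣+∣[p─q]∩r∣+∣q─p─r∣≡∣p─q∣+∣q─r∣ (false ∷ p) (false ∷ q) (true ∷ r) =
  ∣p─r∣+∣[p─q]∩r∣+∣q─p─r∣≡∣p─q∣+∣q─r∣ p q r
∣p─r∣+∣[p─q]∩r∣+∣q─p─r∣≡∣p─q∣+∣q─r∣ (false ∷ p) (false ∷ q) (false ∷ r) =
  ∣p─r∣+∣[p─q]∩r∣+∣q─p─r∣≡∣p─q∣+∣q─r∣ p q r

∣p─r∣≤∣p─q∣+∣q─r∣ : ∀ {n} (p q r : Subset n) → ∣ p ─ r ∣ ≤ ∣ p ─ q ∣ + ∣ q ─ r ∣
∣p─r∣≤∣p─q∣+∣q─r∣ p q r = subst (∣ p ─ r ∣ ≤_) (∣p─r∣+∣[p─q]∩r∣+∣q─p─r∣≡∣p─q∣+∣q─r∣ p q r)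
  (≤-trans (m≤m+n ∣ p ─ r ∣ _) (m≤m+n _ _))

x∈p─q⇒x∉q : ∀ {n} (p q : Subset n) {x} → x ∈ p ─ q → x ∉ q
x∈p─q⇒x∉q (_ ∷ p) (true ∷ q)  (thereᵛ x∈p─q) (thereᵛ x∈q) = x∈p─q⇒x∉q p q x∈p─q x∈q
x∈p─q⇒x∉q (_ ∷ p) (false ∷ q) (thereᵛ x∈p─q) (thereᵛ x∈q) = x∈p─q⇒x∉q p q x∈p─q x∈q

∣p∣≡0⇒x∉p : ∀ {n} {p : Subset n} {x} → ∣ p ∣ ≡ 0 → x ∉ p
∣p∣≡0⇒x∉p ∣p∣≡0 x∈p = n≮0 (<-≤-trans (x∈p⇒∣p-x∣<∣p∣ x∈p) (≤-reflexive ∣p∣≡0))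

∉⇒∣p∣≡0 : ∀ {n} {p : Subset n} → (∀ {x} → x ∉ p) → ∣ p ∣ ≡ 0
∉⇒∣p∣≡0 {n} x∉p = trans (cong ∣_∣ (Empty-unique λ (_ , x∈p) → x∉p x∈p)) (∣⊥∣≡0 n)

p─q⊆p─r×q─p⊆r⇔∣p─q∣+∣q─r∣≤∣p─r∣ : ∀ {n} (p q r : Subset n) →
  (p ─ q ⊆ p ─ r × q ─ p ⊆ r) ⇔ (∣ p ─ q ∣ + ∣ q ─ r ∣ ≤ ∣ p ─ r ∣)
p─q⊆p─r×q─p⊆r⇔∣p─q∣+∣q─r∣≤∣p─r∣ p q r = mk⇔ tight inclusions
  where
  identity = ∣p─r∣+∣[p─q]∩r∣+∣q─p─r∣≡∣p─q∣+∣q─r∣ p q r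

  tight : p ─ q ⊆ p ─ r × q ─ p ⊆ r → ∣ p ─ q ∣ + ∣ q ─ r ∣ ≤ ∣ p ─ r ∣
  tight (p─q⊆p─r , q─p⊆r) = ≤-reflexive (begin
    ∣ p ─ q ∣ + ∣ q ─ r ∣                         ≡⟨ sym identity ⟩
    ∣ p ─ r ∣ + ∣ (p ─ q) ∩ r ∣ + ∣ q ─ p ─ r ∣   ≡⟨ cong₂ (λ a b → ∣ p ─ r ∣ + a + b) ∣[p─q]∩r∣≡0 ∣q─p─r∣≡0 ⟩
    ∣ p ─ r ∣ + 0 + 0                             ≡⟨ trans (+-identityʳ _) (+-identityʳ _) ⟩
    ∣ p ─ r ∣                                     ∎)
    where
    open ≡-Reasoning
    ∣[p─q]∩r∣≡0 : ∣ (p ─ q) ∩ r ∣ ≡ 0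
    ∣[p─q]∩r∣≡0 = ∉⇒∣p∣≡0 λ x∈ → let (x∈p─q , x∈r) = x∈p∩q⁻ (p ─ q) r x∈ in
      x∈p─q⇒x∉q p r (p─q⊆p─r x∈p─q) x∈r
    ∣q─p─r∣≡0 : ∣ q ─ p ─ r ∣ ≡ 0
    ∣q─p─r∣≡0 = ∉⇒∣p∣≡0 λ x∈ → x∈p─q⇒x∉q (q ─ p) r x∈ (q─p⊆r (p─q⊆p (q ─ p) r x∈))

  inclusions : ∣ p ─ q ∣ + ∣ q ─ r ∣ ≤ ∣ p ─ r ∣ → p ─ q ⊆ p ─ r × q ─ p ⊆ r
  inclusions ≤∣p─r∣ = p─q⊆p─r , q─p⊆r
    where
    ∣[p─q]∩r∣+∣q─p─r∣≡0 : ∣ (p ─ q) ∩ r ∣ + ∣ q ─ p ─ r ∣ ≡ 0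
    ∣[p─q]∩r∣+∣q─p─r∣≡0 = n≤0⇒n≡0 (+-cancelˡ-≤ ∣ p ─ r ∣ _ 0 (begin
      ∣ p ─ r ∣ + (∣ (p ─ q) ∩ r ∣ + ∣ q ─ p ─ r ∣) ≡⟨ trans (sym (+-assoc ∣ p ─ r ∣ _ _)) identity ⟩
      ∣ p ─ q ∣ + ∣ q ─ r ∣                         ≤⟨ ≤∣p─r∣ ⟩
      ∣ p ─ r ∣                                     ≡⟨ sym (+-identityʳ _) ⟩
      ∣ p ─ r ∣ + 0                                 ∎))
      where open ≤-Reasoning
    p─q⊆p─r : p ─ q ⊆ p ─ r
    p─q⊆p─r {x} x∈p─q with x ∈? r
    ... | yes x∈r = contradiction (x∈p∩q⁺ (x∈p─q , x∈r)) (∣p∣≡0⇒x∉p (m+n≡0⇒m≡0 _ ∣[p─q]∩r∣+∣q─p─r∣≡0))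
    ... | no x∉r  = x∈p∧x∉q⇒x∈p─q (p─q⊆p p q x∈p─q) x∉r
    q─p⊆r : q ─ p ⊆ r
    q─p⊆r {x} x∈q─p with x ∈? r
    ... | yes x∈r = x∈r
    ... | no x∉r  = contradiction (x∈p∧x∉q⇒x∈p─q x∈q─p x∉r) (∣p∣≡0⇒x∉p (m+n≡0⇒n≡0 _ ∣[p─q]∩r∣+∣q─p─r∣≡0))

dis≡∣─∣ : ∀ {n} {p q : Subset n} → ∣ p ∣ ≡ ∣ q ∣ → dis p q ≡ ∣ p ─ q ∣
dis≡∣─∣ {p = p} {q} ∣p∣≡∣q∣ = begin
  ∣ p ∣ ⊓ ∣ q ∣ ∸ ∣ p ∩ q ∣          ≡⟨ cong (λ m → ∣ p ∣ ⊓ m ∸ ∣ p ∩ q ∣) (sym ∣p∣≡∣q∣) ⟩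
  ∣ p ∣ ⊓ ∣ p ∣ ∸ ∣ p ∩ q ∣          ≡⟨ cong (_∸ ∣ p ∩ q ∣) (⊓-idem ∣ p ∣) ⟩
  ∣ p ∣ ∸ ∣ p ∩ q ∣                  ≡⟨ cong (_∸ ∣ p ∩ q ∣) (sym (∣p─q∣+∣p∩q∣≡∣p∣ p q)) ⟩
  ∣ p ─ q ∣ + ∣ p ∩ q ∣ ∸ ∣ p ∩ q ∣  ≡⟨ m+n∸n≡m ∣ p ─ q ∣ ∣ p ∩ q ∣ ⟩
  ∣ p ─ q ∣                          ∎
  where open ≡-Reasoning

dis-self : ∀ {n} (p : Subset n) → dis p p ≡ 0
dis-self p rewrite ⊓-idem ∣ p ∣ | ∩-idem p = n∸n≡0 ∣ p ∣

dis-sym : ∀ {n} (p q : Subset n) → dis p q ≡ dis q p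
dis-sym p q rewrite ⊓-comm ∣ p ∣ ∣ q ∣ | ∩-comm p q = refl

module _ {V : Set} {E : V → V → Set} where

  walk-map : ∀ {S S' : V → Set} → (∀ {x} → S x → S' x) → ∀ {u v m} → Walk S E u v m → Walk S' E u v m
  walk-map S⊆S' (here s)        = here (S⊆S' s)
  walk-map S⊆S' (step s e walk) = step (S⊆S' s) e (walk-map S⊆S' walk)

  module _ {S : V → Set} where

    walk-head : ∀ {u v m} → Walk S E u v m → S u
    walk-head (here s)     = s
    walk-head (step s _ _) = s

    walk-snoc : ∀ {u v w m} → Walk S E u v m → S w → E v w → Walk S E u w (suc m)
    walk-snoc (here s)        s' e' = step s e' (here s')
    walk-snoc (step s e walk) s' e' = step s e (walk-snoc walk s' e')

    walk-reverse : (∀ {x y} → E x y → E y x) → ∀ {u v m} → Walk S E u v m → Walk S E v u m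
    walk-reverse E-sym (here s)        = here s
    walk-reverse E-sym (step s e walk) = walk-snoc (walk-reverse E-sym walk) s (E-sym e)

    hasDist-unique : ∀ {u v d d'} → HasDist S E u v d → HasDist S E u v d' → d ≡ d'
    hasDist-unique {d = just _}  {just _}  (walk , shortest) (walk' , shortest') =
      cong just (≤-antisym (shortest _ walk') (shortest' _ walk))
    hasDist-unique {d = just _}  {nothing} (walk , _) none = contradiction walk (none _)
    hasDist-unique {d = nothing} {just _}  none (walk , _) = contradiction walk (none _)
    hasDist-unique {d = nothing} {nothing} _ _ = refl

  sameDist : ∀ {S S' u v d} → HasDist S E u v d → HasDist S' E u v d → SameDist S S' E u v
  sameDist {S} {S'} {u} {v} h h' _ = mk⇔
    (λ h₁ → subst (HasDist S' E u v) (hasDist-unique h h₁) h')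
    (λ h₁ → subst (HasDist S E u v) (hasDist-unique h' h₁) h)

  hasDist-resp : ∀ {S S'} → (∀ x → S x ⇔ S' x) → ∀ {u v} d → HasDist S E u v d → HasDist S' E u v d
  hasDist-resp S⇔S' (just _) (walk , shortest) =
    walk-map (to (S⇔S' _)) walk , λ m walk' → shortest m (walk-map (from (S⇔S' _)) walk')
  hasDist-resp S⇔S' nothing none m walk = none m (walk-map (from (S⇔S' _)) walk)

module _ {A : Set} where

  drop-++ : ∀ i (ys zs : List A) → drop i (ys ++ zs) ≡ drop i ys ++ drop (i ∸ length ys) zs
  drop-++ zero    []       zs = refl
  drop-++ zero    (y ∷ ys) zs = refl
  drop-++ (suc i) []       zs = refl
  drop-++ (suc i) (y ∷ ys) zs = drop-++ i ys zs

  ∈-drop-suc⇒∈-drop : ∀ i (xs : List A) {x} → x ∈ˡ drop (suc i) xs → x ∈ˡ drop i xs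
  ∈-drop-suc⇒∈-drop zero    (_ ∷ xs) x∈ = there x∈
  ∈-drop-suc⇒∈-drop (suc i) (_ ∷ xs) x∈ = ∈-drop-suc⇒∈-drop i xs x∈

  ∈-drop-[x]⁻ : ∀ i {x y : A} → y ∈ˡ drop i [ x ] → i ≡ 0 × y ≡ x
  ∈-drop-[x]⁻ zero    (here y≡x) = refl , y≡x
  ∈-drop-[x]⁻ (suc i) y∈ with () ← subst (_ ∈ˡ_) (drop-[] i) y∈

  ∈-drop-reverse⁻ : ∀ (xs : List A) i {y} → y ∈ˡ drop i (reverse xs) →
    ∃[ k ] (toℕ k + i < length xs × lookup xs k ≡ y)
  ∈-drop-reverse⁻ []       zero    ()
  ∈-drop-reverse⁻ []       (suc i) ()
  ∈-drop-reverse⁻ (x ∷ xs) i y∈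
    rewrite unfold-reverse x xs | drop-++ i (reverse xs) [ x ]
    with ∈-++⁻ (drop i (reverse xs)) y∈
  ... | inj₁ y∈xs with k , bound , refl ← ∈-drop-reverse⁻ xs i y∈xs = suc k , s≤s bound , refl
  ... | inj₂ y∈[x] with i∸∣xs∣≡0 , refl ← ∈-drop-[x]⁻ (i ∸ length (reverse xs)) y∈[x] =
    zero , s≤s (subst (i ≤_) (length-reverse xs) (m∸n≡0⇒m≤n i∸∣xs∣≡0)) , refl

  ∈-drop-reverse⁺ : ∀ (xs : List A) i (k : Fin (length xs)) → toℕ k + i < length xs →
    lookup xs k ∈ˡ drop i (reverse xs)
  ∈-drop-reverse⁺ (x ∷ xs) i k bound
    rewrite unfold-reverse x xs | drop-++ i (reverse xs) [ x ] with k | bound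
  ... | suc k | s≤s bound' = ∈-++⁺ˡ (∈-drop-reverse⁺ xs i k bound')
  ... | zero  | s≤s i≤∣xs∣
    rewrite m≤n⇒m∸n≡0 (subst (i ≤_) (sym (length-reverse xs)) i≤∣xs∣) = ∈-++⁺ʳ _ (here refl)

  ∈-drop-reverse⇔ : ∀ (xs : List A) i {y} →
    y ∈ˡ drop i (reverse xs) ⇔ (∃[ k ] (toℕ k + i < length xs × lookup xs k ≡ y))
  ∈-drop-reverse⇔ xs i = mk⇔ (∈-drop-reverse⁻ xs i) λ { (k , bound , refl) → ∈-drop-reverse⁺ xs i k bound }

  ∈-reverse⇔ : ∀ {xs : List A} {x} → x ∈ˡ reverse xs ⇔ x ∈ˡ xs
  ∈-reverse⇔ = mk⇔ reverse⁻ reverse⁺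

  Unique-reverse : ∀ {xs : List A} → Unique xs → Unique (reverse xs)
  Unique-reverse {xs} = ↭ₛ.Unique-resp-↭ (setoid A) (↭⇒↭ₛ (↭-sym (↭-reverse xs)))

  lookup-injective : ∀ {xs : List A} → Unique xs → ∀ i j → lookup xs i ≡ lookup xs j → i ≡ j
  lookup-injective (_ ∷ _)      zero    zero    _  = refl
  lookup-injective (x∉xs ∷ _)   zero    (suc j) eq = contradiction eq (All.lookup x∉xs (∈-lookup j))
  lookup-injective (x∉xs ∷ _)   (suc i) zero    eq = contradiction (sym eq) (All.lookup x∉xs (∈-lookup i))
  lookup-injective (_ ∷ unique) (suc i) (suc j) eq = cong suc (lookup-injective unique i j eq)

facetOrder-reverse : ∀ {n} {Δ : SimplicialComplex n} {Fs} → FacetOrder Δ Fs → FacetOrder Δ (reverse Fs)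
facetOrder-reverse (unique , ∈⇔facet) = Unique-reverse unique , λ F → ⇔.trans ∈-reverse⇔ (∈⇔facet F)

module _ {V : Set} {Vert : V → Set} {E : V → V → Set} {ord : List V}
         (dpo : DistancePreservingOrder Vert E ord) where

  hasDist-drop : ∀ m → suc m < length ord → ∀ {u v} → u ∈ˡ drop m ord → v ∈ˡ drop m ord →
    ∀ d → HasDist Vert E u v d → HasDist (_∈ˡ drop m ord) E u v d
  hasDist-drop zero    _     _  _  d = hasDist-resp (λ x → ⇔.sym (proj₁ (proj₂ dpo) x)) d
  hasDist-drop (suc m) bound u∈ v∈ d hasDist =
    from (proj₂ (proj₂ dpo) (suc m) (s≤s z≤n) bound _ _ u∈ v∈ d)
      (hasDist-drop m (≤-trans (n≤1+n _) bound)
        (∈-drop-suc⇒∈-drop m ord u∈) (∈-drop-suc⇒∈-drop m ord v∈) d hasDist)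

ΓAdj-sym : ∀ {n} {Δ : SimplicialComplex n} {F G} → ΓAdj Δ F G → ΓAdj Δ G F
ΓAdj-sym {F = F} {G} (F-facet , G-facet , dis≡1) = G-facet , F-facet , trans (dis-sym G F) dis≡1

module FacetMetric {n} {Δ : SimplicialComplex n} (pure : Pure Δ) where

  dis≡∣─∣-facets : ∀ {F G} → IsFacet Δ F → IsFacet Δ G → dis F G ≡ ∣ F ─ G ∣
  dis≡∣─∣-facets {F} {G} F-facet G-facet = dis≡∣─∣ {p = F} {G} (pure F G F-facet G-facet)

  dis-triangle : ∀ {F G H} → IsFacet Δ F → IsFacet Δ G → IsFacet Δ H → dis F H ≤ dis F G + dis G H
  dis-triangle {F} {G} {H} F-facet G-facet H-facet
    rewrite dis≡∣─∣-facets {F} {H} F-facet H-facet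
          | dis≡∣─∣-facets {F} {G} F-facet G-facet
          | dis≡∣─∣-facets {G} {H} G-facet H-facet =
    ∣p─r∣≤∣p─q∣+∣q─r∣ F G H

  strongStep⇔geodesicStep : ∀ {F K I} → IsFacet Δ F → IsFacet Δ K → IsFacet Δ I →
    (F ─ K ⊆ F ─ I × K ─ F ⊆ I) ⇔ (dis F K + dis K I ≤ dis F I)
  strongStep⇔geodesicStep {F} {K} {I} F-facet K-facet I-facet
    rewrite dis≡∣─∣-facets {F} {K} F-facet K-facet
          | dis≡∣─∣-facets {K} {I} K-facet I-facet
          | dis≡∣─∣-facets {F} {I} F-facet I-facet =
    p─q⊆p─r×q─p⊆r⇔∣p─q∣+∣q─r∣≤∣p─r∣ F K I

  dis≤walk-length : ∀ {S u v m} → Walk S (ΓAdj Δ) u v m → IsFacet Δ v → dis u v ≤ m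
  dis≤walk-length {u = u} (here _) _ = ≤-reflexive (dis-self u)
  dis≤walk-length {u = u} {v} {suc m} (step {w = w} _ (u-facet , w-facet , dis≡1) walk) v-facet = begin
    dis u v            ≤⟨ dis-triangle {u} {w} {v} u-facet w-facet v-facet ⟩
    dis u w + dis w v  ≡⟨ cong (_+ dis w v) dis≡1 ⟩
    suc (dis w v)      ≤⟨ s≤s (dis≤walk-length walk v-facet) ⟩
    suc m              ∎
    where open ≤-Reasoning

  geodesic⇒hasDist : ∀ {S u v} → Walk S (ΓAdj Δ) u v (dis u v) → IsFacet Δ v →
    HasDist S (ΓAdj Δ) u v (just (dis u v))
  geodesic⇒hasDist walk v-facet = walk , λ _ walk' → dis≤walk-length walk' v-facet

module FromStrongShelling {n} {Δ : SimplicialComplex n} (pure : Pure Δ) {Fs : List (Subset n)}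
                          (shelling : StrongShellingOrder Δ Fs) where

  private
    t = length Fs
    F : Fin t → Subset n
    F = lookup Fs
    E = ΓAdj Δ
    ord = reverse Fs

  open FacetMetric {Δ = Δ} pure

  facetOrder : FacetOrder Δ ord
  facetOrder = facetOrder-reverse {Δ = Δ} (proj₁ shelling)

  facet : ∀ k → IsFacet Δ (F k)
  facet k = to (proj₂ (proj₁ shelling) (F k)) (∈-lookup k)

  shelling-step : ∀ {i j} → i <ᶠ j →
    ∃[ k ] (k <ᶠ j × E (F j) (F k) × dis (F j) (F i) ≡ suc (dis (F k) (F i)))
  shelling-step {i} {j} i<j with k , k<j , ∣Fj─Fk∣≡1 , inclusions ← proj₂ shelling i j i<j =
    k , k<j , (facet j , facet k , dis≡1) , ≤-antisym upper lower
    where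
    dis≡1 : dis (F j) (F k) ≡ 1
    dis≡1 = trans (dis≡∣─∣-facets {F j} {F k} (facet j) (facet k)) ∣Fj─Fk∣≡1
    via-k : dis (F j) (F k) + dis (F k) (F i) ≡ suc (dis (F k) (F i))
    via-k = cong (_+ dis (F k) (F i)) dis≡1
    upper : dis (F j) (F i) ≤ suc (dis (F k) (F i))
    upper = subst (dis (F j) (F i) ≤_) via-k (dis-triangle {F j} {F k} {F i} (facet j) (facet k) (facet i))
    lower : suc (dis (F k) (F i)) ≤ dis (F j) (F i)
    lower = subst (_≤ dis (F j) (F i)) via-k
      (to (strongStep⇔geodesicStep {F j} {F k} {F i} (facet j) (facet k) (facet i)) inclusions)

  initial : ∀ {b} k → toℕ k + b < t → F k ∈ˡ drop b ord
  initial k bound = ∈-drop-reverse⁺ Fs _ k bound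

  geodesic : ∀ d {b} i j → toℕ i + b < t → toℕ j + b < t → dis (F j) (F i) ≡ d →
    Walk (_∈ˡ drop b ord) E (F j) (F i) d
  descent : ∀ d {b} i j → i <ᶠ j → toℕ i + b < t → toℕ j + b < t → dis (F j) (F i) ≡ d →
    Walk (_∈ˡ drop b ord) E (F j) (F i) d

  geodesic d {b} i j bi bj dis≡d with <ᶠ-cmp i j
  ... | tri< i<j _ _ = descent d i j i<j bi bj dis≡d
  ... | tri≈ _ refl _ =
    subst (Walk (_∈ˡ drop b ord) E (F j) (F j)) (trans (sym (dis-self (F j))) dis≡d) (here (initial j bj))
  ... | tri> _ _ j<i =
    walk-reverse (ΓAdj-sym {Δ = Δ}) (descent d j i j<i bj bi (trans (dis-sym (F i) (F j)) dis≡d))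

  descent zero i j i<j _ _ dis≡0 with _ , _ , _ , dis≡suc ← shelling-step i<j =
    contradiction (trans (sym dis≡suc) dis≡0) 1+n≢0
  descent (suc d) {b} i j i<j bi bj dis≡d with k , k<j , adj , dis≡suc ← shelling-step i<j =
    step (initial j bj) adj
      (geodesic d i k bi (<-trans (+-monoˡ-< b k<j) bj) (suc-injective (trans (sym dis≡suc) dis≡d)))

  hasDist-initial : ∀ {b} i j → toℕ i + b < t → toℕ j + b < t →
    HasDist (_∈ˡ drop b ord) E (F j) (F i) (just (dis (F j) (F i)))
  hasDist-initial i j bi bj = geodesic⇒hasDist (geodesic _ i j bi bj refl) (facet i)

  harmonious : Harmonious Δ
  harmonious A B A-facet B-facet
    with k , bk , refl ← to (∈-drop-reverse⇔ Fs 0) (from (proj₂ facetOrder A) A-facet)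
       | l , bl , refl ← to (∈-drop-reverse⇔ Fs 0) (from (proj₂ facetOrder B) B-facet)
    = hasDist-resp (proj₂ facetOrder) _ (hasDist-initial l k bl bk)

  distancePreservingOrder : DistancePreservingOrder (ΓVert Δ) E ord
  distancePreservingOrder = proj₁ facetOrder , proj₂ facetOrder , preserves
    where
    preserves : ∀ i → 1 ≤ i → suc i < length ord → ∀ u v → u ∈ˡ drop i ord → v ∈ˡ drop i ord →
      SameDist (_∈ˡ drop i ord) (_∈ˡ drop (i ∸ 1) ord) E u v
    preserves i _ _ _ _ u∈ v∈
      with k , bk , refl ← to (∈-drop-reverse⇔ Fs i) u∈
         | l , bl , refl ← to (∈-drop-reverse⇔ Fs i) v∈
      = sameDist (hasDist-initial l k bl bk) (hasDist-initial l k (enlarge l bl) (enlarge k bk))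
      where
      enlarge : ∀ k → toℕ k + i < t → toℕ k + (i ∸ 1) < t
      enlarge k bound = ≤-<-trans (+-monoʳ-≤ (toℕ k) (m∸n≤m i 1)) bound

module ToStrongShelling {n} {Δ : SimplicialComplex n} (pure : Pure Δ) (harmonious : Harmonious Δ)
                        {ord : List (Subset n)} (dpo : DistancePreservingOrder (ΓVert Δ) (ΓAdj Δ) ord) where

  private
    Fs = reverse ord
    t = length Fs
    F : Fin t → Subset n
    F = lookup Fs
    E = ΓAdj Δ

  open FacetMetric {Δ = Δ} pure

  facetOrder : FacetOrder Δ Fs
  facetOrder = facetOrder-reverse {Δ = Δ} (proj₁ dpo , proj₁ (proj₂ dpo))

  facet : ∀ k → IsFacet Δ (F k)
  facet k = to (proj₂ facetOrder (F k)) (∈-lookup k)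

  ∈-drop⇔ : ∀ i {x} → x ∈ˡ drop i ord ⇔ (∃[ k ] (toℕ k + i < t × F k ≡ x))
  ∈-drop⇔ i {x} = subst (λ xs → x ∈ˡ drop i xs ⇔ (∃[ k ] (toℕ k + i < t × F k ≡ x)))
    (reverse-involutive ord) (∈-drop-reverse⇔ Fs i)

  StrongStep : Fin t → Fin t → Set
  StrongStep i j = ∃[ k ] (k <ᶠ j × ∣ F j ─ F k ∣ ≡ 1 × F j ─ F k ⊆ F j ─ F i × F k ─ F j ⊆ F i)

  strongStep : ∀ i j → i <ᶠ j → StrongStep i j
  strongStep i j i<j = first-step (proj₁ shortest) refl refl
    where
    m = t ∸ suc (toℕ j)
    suc-j+m≡t : suc (toℕ j) + m ≡ t
    suc-j+m≡t = m+[n∸m]≡n (toℕ<n j)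
    j-last : toℕ j + m < t
    j-last = ≤-reflexive suc-j+m≡t
    i-early : toℕ i + m < t
    i-early = <-trans (+-monoˡ-< m i<j) j-last
    m-bound : suc m < length ord
    m-bound = subst (suc m <_) (length-reverse ord)
      (≤-<-trans (+-monoˡ-≤ m (≤-trans (s≤s z≤n) i<j)) j-last)

    -- drop m ord is F₀ … F_j.
    shortest : HasDist (_∈ˡ drop m ord) E (F j) (F i) (just (dis (F j) (F i)))
    shortest = hasDist-drop dpo m m-bound
      (from (∈-drop⇔ m) (j , j-last , refl)) (from (∈-drop⇔ m) (i , i-early , refl))
      _ (harmonious (F j) (F i) (facet j) (facet i))

    first-step : ∀ {u d} → Walk (_∈ˡ drop m ord) E u (F i) d → u ≡ F j → d ≡ dis (F j) (F i) →
      StrongStep i j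
    first-step (here _) Fi≡Fj _ = contradiction (lookup-injective (proj₁ facetOrder) i j Fi≡Fj) (<ᶠ⇒≢ i<j)
    first-step (step _ (_ , _ , dis≡1) rest) refl d≡dis
      with k , k-early , refl ← to (∈-drop⇔ m) (walk-head rest) =
      k , k<j , trans (sym (dis≡∣─∣-facets {F j} {F k} (facet j) (facet k))) dis≡1 ,
      from (strongStep⇔geodesicStep {F j} {F k} {F i} (facet j) (facet k) (facet i)) geodesicStep
      where
      k≤j : toℕ k ≤ toℕ j
      k≤j = ≤-pred (+-cancelʳ-< m (toℕ k) (suc (toℕ j)) (subst (toℕ k + m <_) (sym suc-j+m≡t) k-early))
      k≢j : toℕ k ≢ toℕ j
      k≢j k≡j with refl ← toℕ-injective k≡j = contradiction (trans (sym (dis-self (F j))) dis≡1) 0≢1+n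
      k<j : k <ᶠ j
      k<j = ≤∧≢⇒< k≤j k≢j
      geodesicStep : dis (F j) (F k) + dis (F k) (F i) ≤ dis (F j) (F i)
      geodesicStep = begin
        dis (F j) (F k) + dis (F k) (F i) ≡⟨ cong (_+ dis (F k) (F i)) dis≡1 ⟩
        suc (dis (F k) (F i))             ≤⟨ s≤s (dis≤walk-length rest (facet i)) ⟩
        suc _                             ≡⟨ d≡dis ⟩
        dis (F j) (F i)                   ∎
        where open ≤-Reasoning

  stronglyShellable : StronglyShellable Δ
  stronglyShellable = Fs , facetOrder , strongStep

theorem4p7 : ∀ {n : ℕ} (Δ : SimplicialComplex n) → Pure Δ →
    StronglyShellable Δ ⇔ (Harmonious Δ × HasDistancePreservingOrder (ΓVert Δ) (ΓAdj Δ))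
theorem4p7 Δ pure = mk⇔
  (λ (Fs , shelling) → let open FromStrongShelling {Δ = Δ} pure shelling in
    harmonious , reverse Fs , distancePreservingOrder)
  (λ (harmonious , ord , dpo) → ToStrongShelling.stronglyShellable {Δ = Δ} pure harmonious dpo)
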